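{- Let $P$ be a path graph on vertex set $[n]_0$ with endpoints $0$ and $n$, viewed as a Cayley tree rooted at $0$. Then the second row $x_1\cdots x_{n-1}$ of the record code $\mathrm{blob}(P)$ is a permutation of $[n-1]$, so $\mathrm{blob}(P)$ (as the map $i\mapsto x_i$) is a permutation in $\mathbb S_{n-1}$. Moreover, if $\pi\in\mathbb S_{n-1}$ is obtained by applying Foata's fundamental transformation to the word of $P$, then $\mathrm{blob}(P)=\pi^{ -1}$.
   Context: For a Cayley tree $T$ on $[n]_0=\{0,\dots,n\}$ rooted at $0$ with parent map $f_T$, a non-root vertex $k$ is a record if $k$ is the largest label on the path from $k$ to the root; with records $r_1<\dots<r_m$, the record code $\mathrm{blob}(T)$ is the two-row array with first row $1,\dots,n-1$ and second row $x_1\cdots x_{n-1}$, where $x_i=f_T(i)$ if $i$ is not a record and $x_{r_j}=f_T(r_{j+1})$ for $j=1,\dots,m-1$. The word of $P$ is the sequence $w_1w_2\cdots w_{n-1}$ of labels of the interior vertices of $P$ read along the path from $0$ towards $n$. Foata's fundamental transformation: cut the word before each left-to-right maximum and read each resulting block $r\,a_1\cdots a_l$ as the cycle $(r\,a_1\cdots a_l)$; the product of these cycles is $\pi$. -}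

module Defs where

open import Data.Nat using (ℕ; zero; suc; _∸_; _⊔_; _≡ᵇ_; _<ᵇ_)
open import Data.Bool using (Bool; true; false; if_then_else_)
open import Data.List using (List; []; _∷_; _++_; map; filter; foldr; reverse; concat; zip; upTo)
open import Data.Product using (_×_; _,_)
open import Relation.Nullary.Decidable using (does)
open import Relation.Binary.PropositionalEquality using (_≡_)
open import Data.Bool.Properties using (T?)
open import Data.Bool using (T)

range1 : ℕ → List ℕ
range1 m = map suc (upTo m)

-- Cayley trees on [n]_0 rooted at 0, given by their parent map f : ℕ → ℕ
-- (only the values on 1..n matter).

pathToRootF : (ℕ → ℕ) → ℕ → ℕ → List ℕ
pathToRootF f zero    k = k ∷ []
pathToRootF f (suc m) k = if k ≡ᵇ 0 then 0 ∷ [] else k ∷ pathToRootF f m (f k)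

-- in a tree on n+1 vertices, a path has at most n edges
pathToRoot : ℕ → (ℕ → ℕ) → ℕ → List ℕ
pathToRoot n f k = pathToRootF f n k

maxList : List ℕ → ℕ
maxList = foldr _⊔_ 0

isRecord : ℕ → (ℕ → ℕ) → ℕ → Bool
isRecord n f k = maxList (pathToRoot n f k) ≡ᵇ k

records : ℕ → (ℕ → ℕ) → List ℕ
records n f = filter (λ k → T? (isRecord n f k)) (range1 n)

nextAfter : List ℕ → ℕ → ℕ
nextAfter []           v = 0
nextAfter (a ∷ [])     v = 0
nextAfter (a ∷ b ∷ rs) v = if v ≡ᵇ a then b else nextAfter (b ∷ rs) v

blob : ℕ → (ℕ → ℕ) → ℕ → ℕ
blob n f i = if isRecord n f i then f (nextAfter (records n f) i) else f i

prevBefore : List ℕ → ℕ → ℕ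
prevBefore []           v = 0
prevBefore (a ∷ [])     v = 0
prevBefore (a ∷ b ∷ rs) v = if v ≡ᵇ b then a else prevBefore (b ∷ rs) v

-- parent map of the path with vertex sequence 0, w_1, ..., w_{n-1}, n
pathParent : ℕ → List ℕ → ℕ → ℕ
pathParent n w = prevBefore (0 ∷ w ++ n ∷ [])

-- cut the word before each left-to-right maximum
blocksGo : ℕ → List ℕ → List ℕ → List (List ℕ)
blocksGo m cur []       = reverse cur ∷ []
blocksGo m cur (x ∷ xs) =
  if m <ᵇ x then reverse cur ∷ blocksGo x (x ∷ []) xs else blocksGo m (x ∷ cur) xs

foataBlocks : List ℕ → List (List ℕ)
foataBlocks []       = []
foataBlocks (x ∷ xs) = blocksGo x (x ∷ []) xs

-- the cycle (c_1 c_2 ... c_k) as the list of pairs c_j ↦ c_{j+1}, c_k ↦ c_1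
rotate : List ℕ → List ℕ
rotate []       = []
rotate (x ∷ xs) = xs ++ x ∷ []

cyclePairs : List ℕ → List (ℕ × ℕ)
cyclePairs c = zip c (rotate c)

lookupPairs : List (ℕ × ℕ) → ℕ → ℕ
lookupPairs []             v = v
lookupPairs ((a , b) ∷ ps) v = if v ≡ᵇ a then b else lookupPairs ps v

-- π = product of the (disjoint) cycles given by the blocks; fixes all other points
foata : List ℕ → ℕ → ℕ
foata w = lookupPairs (concat (map cyclePairs (foataBlocks w)))

-- The path 0 – w₁ – ⋯ – w_{n-1} – n has vertex sequence V = 0 w₁ ⋯ w_{n-1} n: the parent of a
-- vertex is its predecessor in V and its path to the root is the reversed prefix of V before it.
-- So the records are exactly the left-to-right maxima of V, i.e. the heads of the Foata blocks
-- of w together with n. Hence blob sends a non-head entry of a block to its predecessor, and a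
-- block head h to the parent of the next record, which is the last entry of h's block: on each
-- block (h t₁ ⋯ t_k) blob acts as t₁ ↦ h, t_{j+1} ↦ t_j, h ↦ t_k, the inverse of the cycle.

module Submission where

open import Defs
open import Data.Nat using (ℕ; zero; suc; _+_; _≤_; _<_; _∸_; _⊔_; _≡ᵇ_; _<ᵇ_; z≤n; s≤s; s≤s⁻¹)
open import Data.Nat.Properties
open import Data.Bool using (true; false; T; if_then_else_)
open import Data.List using (List; []; _∷_; _++_; _∷ʳ_; map; concat; reverse; zip; length; upTo)
open import Data.List.Properties using (++-assoc; ++-identityʳ; length-++; length-reverse; reverse-involutive; unfold-reverse; map-++; map-∘; map-cong-local; map-upTo; upTo-∷ʳ; length-upTo)
open import Data.List.Relation.Unary.All as All using (All; []; _∷_)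
import Data.List.Relation.Unary.All.Properties as All
import Data.List.Relation.Unary.Any.Properties as Any
open import Data.List.Relation.Unary.Any using (here; there)
open import Data.List.Relation.Unary.AllPairs as AllPairs using (AllPairs; []; _∷_)
import Data.List.Relation.Unary.AllPairs.Properties as AllPairs
open import Data.List.Relation.Unary.Unique.Propositional using (Unique)
import Data.List.Relation.Unary.Unique.Propositional.Properties as Unique
open import Data.List.Membership.Propositional using (_∈_; _∉_)
open import Data.List.Membership.Propositional.Properties
  using (∈-++⁺ˡ; ∈-++⁺ʳ; ∈-++⁻; ∈-∃++; ∈-map⁺; ∈-map⁻; ∈-filter⁺; ∈-filter⁻; ∈-upTo⁺; ∈-upTo⁻)
open import Data.List.Relation.Binary.Permutation.Propositional
  using (_↭_; prep; ↭-refl; ↭-sym; ↭⇒↭ₛ; module PermutationReasoning)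
open import Data.List.Relation.Binary.Permutation.Propositional.Properties
  using (All-resp-↭; ∈-resp-↭; ↭-length; ↭-reverse; ++⁺ʳ; map⁺; ∷↭∷ʳ) renaming (++⁺ to ↭-++⁺)
import Data.List.Relation.Binary.Permutation.Setoid.Properties as Permutationₛ
open import Data.Product using (_×_; _,_; proj₁; proj₂; ∃₂)
open import Data.Sum using (inj₁; inj₂)
open import Data.Unit using (tt)
open import Data.Bool.Properties using (T?)
open import Function using (_∘_)
open import Relation.Nullary using (yes; no; contradiction)
open import Relation.Nullary.Decidable using (dec-true; dec-false)
open import Relation.Binary.PropositionalEquality

-- `does (m ≟ n)` computes to `m ≡ᵇ n`.
≡ᵇ-refl : ∀ m → (m ≡ᵇ m) ≡ true
≡ᵇ-refl m = dec-true (m ≟ m) refl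

≢⇒≡ᵇ-false : ∀ {m n} → m ≢ n → (m ≡ᵇ n) ≡ false
≢⇒≡ᵇ-false {m} {n} = dec-false (m ≟ n)

Unique-resp-↭ : ∀ {xs ys : List ℕ} → xs ↭ ys → Unique xs → Unique ys
Unique-resp-↭ p = Permutationₛ.Unique-resp-↭ (setoid ℕ) (↭⇒↭ₛ p)

Unique[xs++y∷ys]⇒y∉xs : ∀ {A : Set} xs {y : A} {ys} → Unique (xs ++ y ∷ ys) → y ∉ xs
Unique[xs++y∷ys]⇒y∉xs (x ∷ xs) (x≢ ∷ _) (here refl) = All.head (All.++⁻ʳ xs x≢) refl
Unique[xs++y∷ys]⇒y∉xs (x ∷ xs) (_ ∷ u) (there y∈xs) = Unique[xs++y∷ys]⇒y∉xs xs u y∈xs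

prevBefore-adjacent : ∀ xs {a b ys} → Unique (xs ++ a ∷ b ∷ ys) → prevBefore (xs ++ a ∷ b ∷ ys) b ≡ a
prevBefore-adjacent [] {b = b} _ rewrite ≡ᵇ-refl b = refl
prevBefore-adjacent (c ∷ []) (_ ∷ u)
  rewrite ≢⇒≡ᵇ-false (≢-sym (All.head (AllPairs.head u))) = prevBefore-adjacent [] u
prevBefore-adjacent (c ∷ d ∷ xs) (_ ∷ u)
  rewrite ≢⇒≡ᵇ-false (≢-sym (All.lookup (AllPairs.head u) (∈-++⁺ʳ xs (there (here refl))))) =
  prevBefore-adjacent (d ∷ xs) u

maxList≤v⁺ : ∀ {v xs} → All (_≤ v) xs → maxList xs ≤ v
maxList≤v⁺ []            = z≤n
maxList≤v⁺ (x≤v ∷ xs≤v) = ⊔-lub x≤v (maxList≤v⁺ xs≤v)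

∈⇒≤maxList : ∀ {x xs} → x ∈ xs → x ≤ maxList xs
∈⇒≤maxList {xs = y ∷ ys} (here refl)  = m≤m⊔n y (maxList ys)
∈⇒≤maxList {xs = y ∷ ys} (there x∈ys) = ≤-trans (∈⇒≤maxList x∈ys) (m≤n⊔m y (maxList ys))

head≤ : ∀ {x xs y} → AllPairs _<_ (x ∷ xs) → y ∈ x ∷ xs → x ≤ y
head≤ _          (here refl)  = ≤-refl
head≤ (x<xs ∷ _) (there y∈xs) = <⇒≤ (All.lookup x<xs y∈xs)

nextAfter-least : ∀ {L r r′} → AllPairs _<_ L → r ∈ L → r′ ∈ L → r < r′ →
                  (∀ {k} → k ∈ L → r < k → r′ ≤ k) → nextAfter L r ≡ r′
nextAfter-least {_ ∷ []} _ (here refl) (here refl) r<r′ _ = contradiction r<r′ (<-irrefl refl)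
nextAfter-least {a ∷ b ∷ rs} {r} {r′} ((a<b ∷ a<rs) ∷ sorted′) r∈ r′∈ r<r′ least
  with r ≟ a
... | yes refl rewrite ≡ᵇ-refl r = ≤-antisym (b≤r′ r′∈) (least (there (here refl)) a<b)
  where
  b≤r′ : r′ ∈ r ∷ b ∷ rs → b ≤ r′
  b≤r′ (here r′≡r)    = contradiction r<r′ (<-irrefl (sym r′≡r))
  b≤r′ (there r′∈brs) = head≤ sorted′ r′∈brs
... | no r≢a rewrite ≢⇒≡ᵇ-false r≢a with r∈ | r′∈
...   | here r≡a   | _           = contradiction r≡a r≢a
...   | there r∈bs | here refl   = contradiction (All.lookup (a<b ∷ a<rs) r∈bs) (<-asym r<r′)
...   | there r∈bs | there r′∈bs = nextAfter-least sorted′ r∈bs r′∈bs r<r′ (least ∘ there)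

∈-range1⁺ : ∀ {k m} → 0 < k → k ≤ m → k ∈ range1 m
∈-range1⁺ {suc j} _ j<m = ∈-map⁺ suc (∈-upTo⁺ j<m)

∈-range1⁻ : ∀ {k m} → k ∈ range1 m → 0 < k × k ≤ m
∈-range1⁻ k∈ with _ , j∈ , refl ← ∈-map⁻ suc k∈ = s≤s z≤n , ∈-upTo⁻ j∈

range1-sorted : ∀ m → AllPairs _<_ (range1 m)
range1-sorted m = AllPairs.map⁺ (AllPairs.applyUpTo⁺₁ (λ i → i) m (λ i<j _ → s≤s i<j))

range1-unique : ∀ m → Unique (range1 m)
range1-unique m = AllPairs.map <⇒≢ (range1-sorted m)

lookupPairs-∈ : ∀ {ps a b} → Unique (map proj₁ ps) → (a , b) ∈ ps → lookupPairs ps a ≡ b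
lookupPairs-∈ {a = a} _ (here refl) rewrite ≡ᵇ-refl a = refl
lookupPairs-∈ {(c , _) ∷ ps} {a} (c∉ ∷ u) (there ab∈ps)
  rewrite ≢⇒≡ᵇ-false (≢-sym (All.lookup c∉ (∈-map⁺ proj₁ ab∈ps))) = lookupPairs-∈ u ab∈ps

Reverses : (ℕ → ℕ) → ℕ × ℕ → Set
Reverses g (a , b) = g b ≡ a

module _ (g : ℕ → ℕ) {ps : List (ℕ × ℕ)} (g-reverses : All (Reverses g) ps) where

  map-values≡keys : map g (map proj₂ ps) ≡ map proj₁ ps
  map-values≡keys = trans (sym (map-∘ ps)) (map-cong-local g-reverses)

  module _ (keys-unique : Unique (map proj₁ ps)) where

    lookupPairs-inverseˡ : ∀ {b} → b ∈ map proj₂ ps → lookupPairs ps (g b) ≡ b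
    lookupPairs-inverseˡ b∈ with _ , ab∈ , refl ← ∈-map⁻ proj₂ b∈ =
      trans (cong (lookupPairs ps) (All.lookup g-reverses ab∈)) (lookupPairs-∈ keys-unique ab∈)

    lookupPairs-inverseʳ : ∀ {a} → a ∈ map proj₁ ps → g (lookupPairs ps a) ≡ a
    lookupPairs-inverseʳ a∈ with _ , ab∈ , refl ← ∈-map⁻ proj₁ a∈ =
      trans (cong g (lookupPairs-∈ keys-unique ab∈)) (All.lookup g-reverses ab∈)

map-proj₁-cyclePairs : ∀ c → map proj₁ (cyclePairs c) ≡ c
map-proj₁-cyclePairs []       = refl
map-proj₁-cyclePairs (x ∷ xs) = shifted x xs
  where
  shifted : ∀ y ys → map proj₁ (zip (y ∷ ys) (ys ++ x ∷ [])) ≡ y ∷ ys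
  shifted y []       = refl
  shifted y (z ∷ zs) = cong (y ∷_) (shifted z zs)

map-proj₂-cyclePairs : ∀ c → map proj₂ (cyclePairs c) ≡ rotate c
map-proj₂-cyclePairs []       = refl
map-proj₂-cyclePairs (x ∷ xs) = shifted x xs
  where
  shifted : ∀ y ys → map proj₂ (zip (y ∷ ys) (ys ++ x ∷ [])) ≡ ys ++ x ∷ []
  shifted y []       = refl
  shifted y (z ∷ zs) = cong (z ∷_) (shifted z zs)

rotate-↭ : ∀ c → rotate c ↭ c
rotate-↭ []       = ↭-refl
rotate-↭ (x ∷ xs) = ↭-sym (∷↭∷ʳ x xs)

keys-cycles : ∀ bs → map proj₁ (concat (map cyclePairs bs)) ≡ concat bs
keys-cycles []       = refl
keys-cycles (c ∷ bs) =
  trans (map-++ proj₁ (cyclePairs c) _) (cong₂ _++_ (map-proj₁-cyclePairs c) (keys-cycles bs))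

values-cycles : ∀ bs → map proj₂ (concat (map cyclePairs bs)) ↭ concat bs
values-cycles []       = ↭-refl
values-cycles (c ∷ bs) rewrite map-++ proj₂ (cyclePairs c) (concat (map cyclePairs bs))
                             | map-proj₂-cyclePairs c = ↭-++⁺ (rotate-↭ c) (values-cycles bs)

Reverses-zip-map : ∀ g ys → All (Reverses g) (zip (map g ys) ys)
Reverses-zip-map g []       = []
Reverses-zip-map g (y ∷ ys) = refl ∷ Reverses-zip-map g ys

Reverses-cycles : ∀ g {bs} → All (λ c → map g (rotate c) ≡ c) bs →
                  All (Reverses g) (concat (map cyclePairs bs))
Reverses-cycles g = All.concat⁺ ∘ All.map⁺ ∘ All.map reversed
  where
  reversed : ∀ {c} → map g (rotate c) ≡ c → All (Reverses g) (cyclePairs c)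
  reversed {c} g∘rotate≡id =
    subst (λ c′ → All (Reverses g) (zip c′ (rotate c))) g∘rotate≡id (Reverses-zip-map g (rotate c))

-- Foata blocks: every head is a new left-to-right maximum, and `lo` bounds all entries before the blocks.
data LRMaxBlocks : ℕ → List (List ℕ) → Set where
  []    : ∀ {lo} → LRMaxBlocks lo []
  block : ∀ {lo h t bs} → lo < h → All (_≤ h) t → LRMaxBlocks h bs → LRMaxBlocks lo ((h ∷ t) ∷ bs)

LRMaxBlocks-nextHead : ∀ {h bs n} → LRMaxBlocks h bs → h < n →
                       ∃₂ λ r R → concat bs ++ n ∷ [] ≡ r ∷ R × h < r
LRMaxBlocks-nextHead {n = n} []  h<n = n , [] , refl , h<n
LRMaxBlocks-nextHead (block h<h′ _ _) _ = _ , _ , refl , h<h′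

blocksGo-spec : ∀ m cur xs → ∃₂ λ t bs →
  blocksGo m cur xs ≡ (reverse cur ++ t) ∷ bs × xs ≡ t ++ concat bs × All (_≤ m) t × LRMaxBlocks m bs
blocksGo-spec m cur []       = [] , [] , cong (_∷ []) (sym (++-identityʳ _)) , refl , [] , []
blocksGo-spec m cur (x ∷ xs) with m <ᵇ x in m<ᵇx
... | true  with t , bs , go≡ , refl , t≤x , blocks ← blocksGo-spec x (x ∷ []) xs =
  [] , (x ∷ t) ∷ bs , cong₂ _∷_ (sym (++-identityʳ _)) go≡ , refl , [] ,
  block (<ᵇ⇒< m x (subst T (sym m<ᵇx) tt)) t≤x blocks
... | false with t , bs , go≡ , refl , t≤m , blocks ← blocksGo-spec m (x ∷ cur) xs =
  x ∷ t , bs , trans go≡ (cong (_∷ bs) reverse-∷-++) , refl ,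
  ≮⇒≥ (λ m<x → subst T m<ᵇx (<⇒<ᵇ m<x)) ∷ t≤m , blocks
  where
  reverse-∷-++ : reverse (x ∷ cur) ++ t ≡ reverse cur ++ x ∷ t
  reverse-∷-++ = trans (cong (_++ t) (unfold-reverse x cur)) (++-assoc (reverse cur) (x ∷ []) t)

foataBlocks-spec : ∀ {w} → All (0 <_) w → LRMaxBlocks 0 (foataBlocks w) × concat (foataBlocks w) ≡ w
foataBlocks-spec [] = [] , refl
foataBlocks-spec {x ∷ xs} (0<x ∷ _) with t , bs , go≡ , refl , t≤x , blocks ← blocksGo-spec x (x ∷ []) xs
  rewrite go≡ = block 0<x t≤x blocks , refl

pathToRootF-prevBefore : ∀ {vs} → Unique (0 ∷ vs) → ∀ rs {b ys} fuel →
  0 ∷ vs ≡ reverse rs ++ b ∷ ys → length rs ≤ fuel →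
  pathToRootF (prevBefore (0 ∷ vs)) fuel b ≡ b ∷ rs
pathToRootF-prevBefore _ []       zero    refl _ = refl
pathToRootF-prevBefore _ []       (suc _) refl _ = refl
pathToRootF-prevBefore {vs} u (c ∷ rs) {b} {ys} (suc fuel) V≡ (s≤s |rs|≤fuel) = begin
  (if b ≡ᵇ 0 then 0 ∷ [] else b ∷ pathToRootF f fuel (f b))
    ≡⟨ cong (if_then 0 ∷ [] else b ∷ pathToRootF f fuel (f b)) (≢⇒≡ᵇ-false b≢0) ⟩
  b ∷ pathToRootF f fuel (f b)
    ≡⟨ cong (λ a → b ∷ pathToRootF f fuel a) f-b ⟩
  b ∷ pathToRootF f fuel c
    ≡⟨ cong (b ∷_) (pathToRootF-prevBefore u rs fuel V≡′ |rs|≤fuel) ⟩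
  b ∷ c ∷ rs
    ∎
  where
  open ≡-Reasoning
  f : ℕ → ℕ
  f = prevBefore (0 ∷ vs)
  V≡′ : 0 ∷ vs ≡ reverse rs ++ c ∷ b ∷ ys
  V≡′ = trans V≡ (trans (cong (_++ b ∷ ys) (unfold-reverse c rs))
                        (++-assoc (reverse rs) (c ∷ []) (b ∷ ys)))
  f-b : f b ≡ c
  f-b = trans (cong (λ L → prevBefore L b) V≡′) (prevBefore-adjacent (reverse rs) (subst Unique V≡′ u))
  ∈-tail : ∀ {x : ℕ} {xs} zs → x ∷ xs ≡ zs ++ c ∷ b ∷ ys → b ∈ xs
  ∈-tail []       refl = here refl
  ∈-tail (_ ∷ zs) refl = ∈-++⁺ʳ zs (there (here refl))
  b≢0 : b ≢ 0
  b≢0 b≡0 = All.lookup (AllPairs.head u) (∈-tail (reverse rs) V≡′) (sym b≡0)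

module PathGraph (m : ℕ) {w : List ℕ} (w↭ : w ↭ range1 m) where

  n : ℕ
  n = suc m

  V : List ℕ
  V = 0 ∷ w ++ n ∷ []

  f : ℕ → ℕ
  f = pathParent n w

  β : ℕ → ℕ
  β = blob n f

  V↭upTo : V ↭ upTo (suc n)
  V↭upTo = subst (V ↭_) (trans (cong (λ xs → 0 ∷ xs ∷ʳ n) (map-upTo suc m)) (upTo-∷ʳ n))
                 (prep 0 (++⁺ʳ (n ∷ []) w↭))

  V-unique : Unique V
  V-unique = Unique-resp-↭ (↭-sym V↭upTo) (Unique.upTo⁺ (suc n))

  ∈V⇒≤n : ∀ {k} → k ∈ V → k ≤ n
  ∈V⇒≤n k∈V = s≤s⁻¹ (∈-upTo⁻ (∈-resp-↭ V↭upTo k∈V))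

  ≤n⇒∈V : ∀ {k} → k ≤ n → k ∈ V
  ≤n⇒∈V k≤n = ∈-resp-↭ (↭-sym V↭upTo) (∈-upTo⁺ (s≤s k≤n))

  prefix-length : ∀ xs {b ys} → V ≡ xs ++ b ∷ ys → length xs ≤ n
  prefix-length xs {b} {ys} V≡ = s≤s⁻¹ (begin-strict
    length xs                     <⟨ m<m+n (length xs) (s≤s z≤n) ⟩
    length xs + length (b ∷ ys)   ≡⟨ length-++ xs ⟨
    length (xs ++ b ∷ ys)         ≡⟨ cong length V≡ ⟨
    length V                      ≡⟨ ↭-length V↭upTo ⟩
    length (upTo (suc n))         ≡⟨ length-upTo (suc n) ⟩
    suc n                         ∎)
    where open ≤-Reasoning

  parent : ∀ xs {a b ys} → V ≡ xs ++ a ∷ b ∷ ys → f b ≡ a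
  parent xs {b = b} V≡ =
    trans (cong (λ L → prevBefore L b) V≡) (prevBefore-adjacent xs (subst Unique V≡ V-unique))

  pathToRoot-position : ∀ xs {b ys} → V ≡ xs ++ b ∷ ys → pathToRoot n f b ≡ b ∷ reverse xs
  pathToRoot-position xs {b} {ys} V≡ =
    pathToRootF-prevBefore V-unique (reverse xs) n
      (trans V≡ (cong (_++ b ∷ ys) (sym (reverse-involutive xs))))
      (≤-trans (≤-reflexive (length-reverse xs)) (prefix-length xs V≡))

  isRecord-prefixMax : ∀ xs {b ys} → V ≡ xs ++ b ∷ ys → All (_≤ b) xs → isRecord n f b ≡ true
  isRecord-prefixMax xs {b} V≡ xs≤b = begin
    maxList (pathToRoot n f b) ≡ᵇ b    ≡⟨ cong (λ p → maxList p ≡ᵇ b) (pathToRoot-position xs V≡) ⟩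
    b ⊔ maxList (reverse xs) ≡ᵇ b      ≡⟨ cong (_≡ᵇ b) (m≥n⇒m⊔n≡m max≤b) ⟩
    b ≡ᵇ b                             ≡⟨ ≡ᵇ-refl b ⟩
    true                               ∎
    where
    open ≡-Reasoning
    max≤b : maxList (reverse xs) ≤ b
    max≤b = maxList≤v⁺ (All-resp-↭ (↭-sym (↭-reverse xs)) xs≤b)

  isRecord-dominated : ∀ xs {c ys b} → V ≡ xs ++ c ∷ ys → b ∈ ys → b ≤ c → isRecord n f b ≡ false
  isRecord-dominated xs {c} {ys} {b} V≡ b∈ys b≤c with ys₁ , ys₂ , refl ← ∈-∃++ b∈ys = begin
    maxList (pathToRoot n f b) ≡ᵇ b    ≡⟨ cong (λ p → maxList p ≡ᵇ b) (pathToRoot-position pre V≡′) ⟩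
    b ⊔ maxList (reverse pre) ≡ᵇ b     ≡⟨ ≢⇒≡ᵇ-false b⊔max≢b ⟩
    false                              ∎
    where
    open ≡-Reasoning
    pre : List ℕ
    pre = xs ++ c ∷ ys₁
    V≡′ : V ≡ pre ++ b ∷ ys₂
    V≡′ = trans V≡ (sym (++-assoc xs (c ∷ ys₁) (b ∷ ys₂)))
    c∈pre : c ∈ pre
    c∈pre = ∈-++⁺ʳ xs (here refl)
    b<c : b < c
    b<c = ≤∧≢⇒< b≤c λ b≡c →
      Unique[xs++y∷ys]⇒y∉xs pre (subst Unique V≡′ V-unique) (subst (_∈ pre) (sym b≡c) c∈pre)
    b⊔max≢b : b ⊔ maxList (reverse pre) ≢ b
    b⊔max≢b b⊔max≡b =
      <⇒≱ b<c (subst (c ≤_) b⊔max≡b (m≤n⇒m≤o⊔n b (∈⇒≤maxList (Any.reverse⁺ c∈pre))))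

  records-sorted : AllPairs _<_ (records n f)
  records-sorted = AllPairs.filter⁺ (λ k → T? (isRecord n f k)) (range1-sorted n)

  ∈-records : ∀ {k} → 0 < k → k ≤ n → isRecord n f k ≡ true → k ∈ records n f
  ∈-records 0<k k≤n k-rec =
    ∈-filter⁺ (λ k → T? (isRecord n f k)) (∈-range1⁺ 0<k k≤n) (subst T (sym k-rec) tt)

  nextAfter-records : ∀ xs {r ys h} → V ≡ xs ++ r ∷ ys → All (_≤ h) xs → h < r → 0 < h →
                      isRecord n f h ≡ true → nextAfter (records n f) h ≡ r
  nextAfter-records xs {r} {ys} {h} V≡ xs≤h h<r 0<h h-rec =
    nextAfter-least records-sorted (∈-records 0<h (<⇒≤ (<-≤-trans h<r r≤n)) h-rec)
                    (∈-records (<-trans 0<h h<r) r≤n r-rec) h<r r-least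
    where
    r≤n : r ≤ n
    r≤n = ∈V⇒≤n (subst (r ∈_) (sym V≡) (∈-++⁺ʳ xs (here refl)))
    r-rec : isRecord n f r ≡ true
    r-rec = isRecord-prefixMax xs V≡ (All.map (λ k≤h → <⇒≤ (≤-<-trans k≤h h<r)) xs≤h)
    r-least : ∀ {k} → k ∈ records n f → h < k → r ≤ k
    r-least {k} k∈ h<k with k∈range , k-rec ← ∈-filter⁻ (λ k → T? (isRecord n f k)) k∈
      with ∈-++⁻ xs (subst (k ∈_) V≡ (≤n⇒∈V (proj₂ (∈-range1⁻ k∈range))))
    ... | inj₁ k∈xs        = contradiction (All.lookup xs≤h k∈xs) (<⇒≱ h<k)
    ... | inj₂ (here refl) = ≤-refl
    ... | inj₂ (there k∈ys) = ≮⇒≥ (λ k<r → subst T (isRecord-dominated xs V≡ k∈ys (<⇒≤ k<r)) k-rec)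

  β-nonRecord : ∀ {b} → isRecord n f b ≡ false → β b ≡ f b
  β-nonRecord {b} = cong (if_then f (nextAfter (records n f) b) else f b)

  β-record : ∀ {b} → isRecord n f b ≡ true → β b ≡ f (nextAfter (records n f) b)
  β-record {b} = cong (if_then f (nextAfter (records n f) b) else f b)

  β-shifts : ∀ pre p s {x r R} → V ≡ pre ++ p ∷ s ++ r ∷ R → All (λ b → isRecord n f b ≡ false) s →
             β x ≡ f r → map β (s ++ x ∷ []) ≡ p ∷ s
  β-shifts pre p []      V≡ []                     βx≡ = cong (_∷ []) (trans βx≡ (parent pre V≡))
  β-shifts pre p (b ∷ s) V≡ (b-nonRec ∷ s-nonRec) βx≡ =
    cong₂ _∷_ (trans (β-nonRecord b-nonRec) (parent pre V≡))
              (β-shifts (pre ++ p ∷ []) b s (trans V≡ (sym (++-assoc pre (p ∷ []) _))) s-nonRec βx≡)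

  β-rotate-block : ∀ pre {h t r R} → V ≡ pre ++ h ∷ t ++ r ∷ R → All (_≤ h) pre → All (_≤ h) t →
                   h < r → 0 < h → map β (rotate (h ∷ t)) ≡ h ∷ t
  β-rotate-block pre {h} {t} {r} {R} V≡ pre≤h t≤h h<r 0<h = β-shifts pre h t V≡ t-nonRec βh≡fr
    where
    h-rec : isRecord n f h ≡ true
    h-rec = isRecord-prefixMax pre V≡ pre≤h
    t-nonRec : All (λ b → isRecord n f b ≡ false) t
    t-nonRec = All.tabulate (λ b∈t → isRecord-dominated pre V≡ (∈-++⁺ˡ b∈t) (All.lookup t≤h b∈t))
    βh≡fr : β h ≡ f r
    βh≡fr = trans (β-record h-rec) (cong f (nextAfter-records (pre ++ h ∷ t)
              (trans V≡ (sym (++-assoc pre (h ∷ t) (r ∷ R)))) (All.++⁺ pre≤h (≤-refl ∷ t≤h)) h<r 0<h h-rec))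

  β-rotate-blocks : ∀ pre {lo bs} → V ≡ pre ++ concat bs ++ n ∷ [] → All (_≤ lo) pre →
                    LRMaxBlocks lo bs → All (_< n) (concat bs) → All (λ c → map β (rotate c) ≡ c) bs
  β-rotate-blocks _ _ _ [] _ = []
  β-rotate-blocks pre {bs = (h ∷ t) ∷ bs} V≡ pre≤lo (block lo<h t≤h blocks) bs<n
    with r , R , rest≡ , h<r ← LRMaxBlocks-nextHead blocks (All.head bs<n) =
    β-rotate-block pre V≡₁ pre≤h t≤h h<r (≤-<-trans z≤n lo<h) ∷
    β-rotate-blocks (pre ++ h ∷ t) V≡₂ (All.++⁺ pre≤h (≤-refl ∷ t≤h)) blocks (All.++⁻ʳ (h ∷ t) bs<n)
    where
    pre≤h : All (_≤ h) pre
    pre≤h = All.map (λ k≤lo → ≤-trans k≤lo (<⇒≤ lo<h)) pre≤lo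
    block++rest : ((h ∷ t) ++ concat bs) ++ n ∷ [] ≡ (h ∷ t) ++ concat bs ++ n ∷ []
    block++rest = ++-assoc (h ∷ t) (concat bs) (n ∷ [])
    V≡₁ : V ≡ pre ++ h ∷ t ++ r ∷ R
    V≡₁ = trans V≡ (cong (pre ++_) (trans block++rest (cong ((h ∷ t) ++_) rest≡)))
    V≡₂ : V ≡ (pre ++ h ∷ t) ++ concat bs ++ n ∷ []
    V≡₂ = trans V≡ (trans (cong (pre ++_) block++rest) (sym (++-assoc pre (h ∷ t) _)))

  w-bounds : All (λ k → 0 < k × k ≤ m) w
  w-bounds = All-resp-↭ (↭-sym w↭) (All.tabulate ∈-range1⁻)

  foataBlocks-w : LRMaxBlocks 0 (foataBlocks w) × concat (foataBlocks w) ≡ w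
  foataBlocks-w = foataBlocks-spec (All.map proj₁ w-bounds)

  β-reverses-foata : All (Reverses β) (concat (map cyclePairs (foataBlocks w)))
  β-reverses-foata =
    Reverses-cycles β (β-rotate-blocks (0 ∷ []) V≡ (z≤n ∷ []) (proj₁ foataBlocks-w) blocks<n)
    where
    concat≡w : concat (foataBlocks w) ≡ w
    concat≡w = proj₂ foataBlocks-w
    V≡ : V ≡ (0 ∷ []) ++ concat (foataBlocks w) ++ n ∷ []
    V≡ = cong (λ xs → 0 ∷ xs ++ n ∷ []) (sym concat≡w)
    blocks<n : All (_< n) (concat (foataBlocks w))
    blocks<n = subst (All (_< n)) (sym concat≡w) (All.map (s≤s ∘ proj₂) w-bounds)

lemma2p6 : (n : ℕ) → 1 ≤ n → (w : List ℕ) → w ↭ range1 (n ∸ 1) →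
    (map (blob n (pathParent n w)) (range1 (n ∸ 1)) ↭ range1 (n ∸ 1))
    × ((i : ℕ) → 1 ≤ i → i ≤ n ∸ 1 →
        (foata w (blob n (pathParent n w) i) ≡ i)
        × (blob n (pathParent n w) (foata w i) ≡ i))
lemma2p6 (suc m) _ w w↭ = permutation , inverse
  where
  open PathGraph m w↭
  P : List (ℕ × ℕ)
  P = concat (map cyclePairs (foataBlocks w))
  keys≡w : map proj₁ P ≡ w
  keys≡w = trans (keys-cycles (foataBlocks w)) (proj₂ foataBlocks-w)
  values↭w : map proj₂ P ↭ w
  values↭w = subst (map proj₂ P ↭_) (proj₂ foataBlocks-w) (values-cycles (foataBlocks w))
  keys-unique : Unique (map proj₁ P)
  keys-unique = subst Unique (sym keys≡w) (Unique-resp-↭ (↭-sym w↭) (range1-unique m))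
  inverse : ∀ i → 1 ≤ i → i ≤ m → foata w (β i) ≡ i × β (foata w i) ≡ i
  inverse i 1≤i i≤m =
    lookupPairs-inverseˡ β β-reverses-foata keys-unique (∈-resp-↭ (↭-sym values↭w) i∈w) ,
    lookupPairs-inverseʳ β β-reverses-foata keys-unique (subst (i ∈_) (sym keys≡w) i∈w)
    where
    i∈w : i ∈ w
    i∈w = ∈-resp-↭ (↭-sym w↭) (∈-range1⁺ 1≤i i≤m)
  permutation : map β (range1 m) ↭ range1 m
  permutation = begin
    map β (range1 m)     ↭⟨ map⁺ β (↭-sym w↭) ⟩
    map β w              ↭⟨ map⁺ β values↭w ⟨
    map β (map proj₂ P)  ≡⟨ map-values≡keys β β-reverses-foata ⟩
    map proj₁ P          ≡⟨ keys≡w ⟩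
    w                    ↭⟨ w↭ ⟩
    range1 m             ∎
    where open PermutationReasoning
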